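{- Let $\mathcal{A}$ be a typed combinatory algebra over a type system $\mathcal{T}$, and let $\mathcal{A}^1$ be its augmentation by a unit type. Then the categories of assemblies $\mathbf{Asm}(\mathcal{A})$ and $\mathbf{Asm}(\mathcal{A}^1)$ are equivalent: $\mathbf{Asm}(\mathcal{A})\simeq\mathbf{Asm}(\mathcal{A}^1)$.
   Context: A type system is a non-empty set $\mathcal{T}$ of "types" closed under a binary operation $\to$ (associating to the right). A typed combinatory algebra (TCA) $\mathcal{A}$ over $\mathcal{T}$ is a family $(\mathcal{A}_A)_{A\in\mathcal{T}}$ of non-empty sets with application maps $\cdot_{A,B}:\mathcal{A}_{A\to B}\times\mathcal{A}_A\to\mathcal{A}_B$ (written by juxtaposition, left associative) such that there exist elements $\mathsf{k}_{A,B}\in\mathcal{A}_{A\to B\to A}$ and $\mathsf{s}_{A,B,C}\in\mathcal{A}_{(A\to B\to C)\to(A\to B)\to A\to C}$ with $\mathsf{k}ab=a$ and $\mathsf{s}fga=fa(ga)$ for all arguments of the right types. The augmentation $\mathcal{A}^1$ is the TCA over the type system $\mathcal{T}^1=\mathcal{T}\cup\{1\}$ (with a new type $1$) in which $1\to A:=A$ and $A\to 1:=1$ for all $A\in\mathcal{T}^1$, with $\mathcal{A}^1_1:=\{*\}$, $\mathcal{A}^1_A:=\mathcal{A}_A$ for $A\in\mathcal{T}$, application as in $\mathcal{A}$ on types of $\mathcal{T}$, and $a\cdot_{1\to A}*:=a$, $*\cdot_{A\to 1}a:=*$ (with suitable combinators, which exist by typed combinatory completeness of $\mathcal{A}$).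 For a TCA $\mathcal{A}$, the category $\mathbf{Asm}(\mathcal{A})$ has as objects triples $(X,A,\Vdash_X)$ with $X$ a set, $A$ a type and $\Vdash_X\subseteq\mathcal{A}_A\times X$ such that every $x\in X$ has some $a\in\mathcal{A}_A$ with $a\Vdash_X x$; a morphism $(X,A,\Vdash_X)\to(Y,B,\Vdash_Y)$ is a function $f:X\to Y$ for which there exists $e\in\mathcal{A}_{A\to B}$ with $ea\Vdash_Y f(x)$ whenever $a\Vdash_X x$. Identities and composition are those of functions. -}

module Defs where

open import Level using (Level; _⊔_) renaming (suc to lsuc; zero to lzero)
open import Data.Unit using (⊤; tt)
open import Data.Maybe using (Maybe; nothing; just)
open import Data.Product using (Σ; ∃; _,_; proj₁; proj₂)
open import Relation.Binary.PropositionalEquality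
  using (_≡_; refl; sym; trans; cong; cong₂; isEquivalence)
open import Relation.Binary using (Rel; IsEquivalence)

record TCA : Set₁ where
  field
    Ty      : Set
    _⇒_     : Ty → Ty → Ty
    ty₀     : Ty                       -- the type system is non-empty
    𝒜       : Ty → Set
    inhab   : (A : Ty) → 𝒜 A
    _·_     : ∀ {A B} → 𝒜 (A ⇒ B) → 𝒜 A → 𝒜 B
    k       : ∀ {A B} → 𝒜 (A ⇒ (B ⇒ A))
    s       : ∀ {A B C} → 𝒜 ((A ⇒ (B ⇒ C)) ⇒ ((A ⇒ B) ⇒ (A ⇒ C)))
    k-eq    : ∀ {A B} (a : 𝒜 A) (b : 𝒜 B) → (k · a) · b ≡ a
    s-eq    : ∀ {A B C} (f : 𝒜 (A ⇒ (B ⇒ C))) (g : 𝒜 (A ⇒ B)) (a : 𝒜 A) →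
              ((s · f) · g) · a ≡ (f · a) · (g · a)
  infixl 9 _·_

  i : ∀ {A} → 𝒜 (A ⇒ A)
  i {A} = (s {A} {A ⇒ A} {A} · k) · k

  i-eq : ∀ {A} (a : 𝒜 A) → i · a ≡ a
  i-eq {A} a = trans (s-eq k k a) (k-eq a (k · a))

  comp : ∀ {A B C} → 𝒜 (B ⇒ C) → 𝒜 (A ⇒ B) → 𝒜 (A ⇒ C)
  comp {A} {B} {C} g f = (s {A} {B} {C} · (k · g)) · f

  comp-eq : ∀ {A B C} (g : 𝒜 (B ⇒ C)) (f : 𝒜 (A ⇒ B)) (a : 𝒜 A) →
            comp g f · a ≡ g · (f · a)
  comp-eq g f a = trans (s-eq (k · g) f a) (cong (_· (f · a)) (k-eq g a))

-- The augmentation 𝒜¹ by a unit type 1 (represented by `nothing`)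

module Augmentation (T : TCA) where
  open TCA T

  Ty¹ : Set
  Ty¹ = Maybe Ty

  _⇒¹_ : Ty¹ → Ty¹ → Ty¹
  nothing ⇒¹ B       = B
  just A  ⇒¹ nothing = nothing
  just A  ⇒¹ just B  = just (A ⇒ B)

  𝒜¹ : Ty¹ → Set
  𝒜¹ nothing  = ⊤
  𝒜¹ (just A) = 𝒜 A

  inhab¹ : (A : Ty¹) → 𝒜¹ A
  inhab¹ nothing  = tt
  inhab¹ (just A) = inhab A

  app¹ : ∀ {A B} → 𝒜¹ (A ⇒¹ B) → 𝒜¹ A → 𝒜¹ B
  app¹ {nothing} {B}       a _ = a
  app¹ {just A}  {nothing} _ _ = tt
  app¹ {just A}  {just B}  f a = f · a

  k¹ : ∀ {A B} → 𝒜¹ (A ⇒¹ (B ⇒¹ A))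
  k¹ {nothing} {nothing} = tt
  k¹ {nothing} {just B}  = tt
  k¹ {just A}  {nothing} = i
  k¹ {just A}  {just B}  = k

  k¹-eq : ∀ {A B} (a : 𝒜¹ A) (b : 𝒜¹ B) → app¹ {B} {A} (app¹ {A} {B ⇒¹ A} (k¹ {A} {B}) a) b ≡ a
  k¹-eq {nothing} {nothing} a b = refl
  k¹-eq {nothing} {just B}  a b = refl
  k¹-eq {just A}  {nothing} a b = i-eq a
  k¹-eq {just A}  {just B}  a b = k-eq a b

  s¹ : ∀ {A B C} → 𝒜¹ ((A ⇒¹ (B ⇒¹ C)) ⇒¹ ((A ⇒¹ B) ⇒¹ (A ⇒¹ C)))
  s¹ {nothing} {nothing} {nothing} = tt
  s¹ {nothing} {just B}  {nothing} = tt
  s¹ {just A}  {nothing} {nothing} = tt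
  s¹ {just A}  {just B}  {nothing} = tt
  s¹ {nothing} {nothing} {just C}  = i
  s¹ {nothing} {just B}  {just C}  = i
  s¹ {just A}  {nothing} {just C}  = i
  s¹ {just A}  {just B}  {just C}  = s

  s¹-eq : ∀ {A B C} (f : 𝒜¹ (A ⇒¹ (B ⇒¹ C))) (g : 𝒜¹ (A ⇒¹ B)) (a : 𝒜¹ A) →
          app¹ {A} {C} (app¹ {A ⇒¹ B} {A ⇒¹ C}
                 (app¹ {A ⇒¹ (B ⇒¹ C)} {(A ⇒¹ B) ⇒¹ (A ⇒¹ C)} (s¹ {A} {B} {C}) f) g) a
          ≡ app¹ {B} {C} (app¹ {A} {B ⇒¹ C} f a) (app¹ {A} {B} g a)
  s¹-eq {nothing} {nothing} {nothing} f g a = refl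
  s¹-eq {nothing} {just B}  {nothing} f g a = refl
  s¹-eq {just A}  {nothing} {nothing} f g a = refl
  s¹-eq {just A}  {just B}  {nothing} f g a = refl
  s¹-eq {nothing} {nothing} {just C}  f g a = i-eq f
  s¹-eq {nothing} {just B}  {just C}  f g a = cong (_· g) (i-eq f)
  s¹-eq {just A}  {nothing} {just C}  f g a = cong (_· a) (i-eq f)
  s¹-eq {just A}  {just B}  {just C}  f g a = s-eq f g a

Aug : TCA → TCA
Aug T = record
  { Ty = Ty¹ ; _⇒_ = _⇒¹_ ; ty₀ = nothing ; 𝒜 = 𝒜¹ ; inhab = inhab¹
  ; _·_ = λ {A} {B} → app¹ {A} {B}
  ; k = λ {A} {B} → k¹ {A} {B} ; s = λ {A} {B} {C} → s¹ {A} {B} {C}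
  ; k-eq = λ {A} {B} → k¹-eq {A} {B} ; s-eq = λ {A} {B} {C} → s¹-eq {A} {B} {C} }
  where open Augmentation T

record Category (o ℓ e : Level) : Set (lsuc (o ⊔ ℓ ⊔ e)) where
  infix  4 _≈_
  infixr 9 _∘_
  field
    Obj       : Set o
    Hom       : Obj → Obj → Set ℓ
    _≈_       : ∀ {X Y} → Rel (Hom X Y) e
    id        : ∀ {X} → Hom X X
    _∘_       : ∀ {X Y Z} → Hom Y Z → Hom X Y → Hom X Z
    equiv     : ∀ {X Y} → IsEquivalence (_≈_ {X} {Y})
    ∘-resp-≈  : ∀ {X Y Z} {f h : Hom Y Z} {g i : Hom X Y} →
                f ≈ h → g ≈ i → f ∘ g ≈ h ∘ i
    identityˡ : ∀ {X Y} {f : Hom X Y} → id ∘ f ≈ f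
    identityʳ : ∀ {X Y} {f : Hom X Y} → f ∘ id ≈ f
    assoc     : ∀ {W X Y Z} {f : Hom W X} {g : Hom X Y} {h : Hom Y Z} →
                (h ∘ g) ∘ f ≈ h ∘ (g ∘ f)

record Functor {o ℓ e o′ ℓ′ e′} (C : Category o ℓ e) (D : Category o′ ℓ′ e′)
       : Set (o ⊔ ℓ ⊔ e ⊔ o′ ⊔ ℓ′ ⊔ e′) where
  private
    module C = Category C
    module D = Category D
  field
    F₀           : C.Obj → D.Obj
    F₁           : ∀ {X Y} → C.Hom X Y → D.Hom (F₀ X) (F₀ Y)
    identity     : ∀ {X} → F₁ (C.id {X}) D.≈ D.id
    homomorphism : ∀ {X Y Z} {f : C.Hom X Y} {g : C.Hom Y Z} →
                   F₁ (g C.∘ f) D.≈ F₁ g D.∘ F₁ f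
    F-resp-≈     : ∀ {X Y} {f g : C.Hom X Y} → f C.≈ g → F₁ f D.≈ F₁ g

idF : ∀ {o ℓ e} {C : Category o ℓ e} → Functor C C
idF {C = C} = record
  { F₀ = λ X → X ; F₁ = λ f → f
  ; identity = IsEquivalence.refl equiv
  ; homomorphism = IsEquivalence.refl equiv
  ; F-resp-≈ = λ p → p }
  where open Category C

_∘F_ : ∀ {o ℓ e o′ ℓ′ e′ o″ ℓ″ e″}
         {C : Category o ℓ e} {D : Category o′ ℓ′ e′} {E : Category o″ ℓ″ e″} →
       Functor D E → Functor C D → Functor C E
_∘F_ {E = E} G F = record
  { F₀ = λ X → G.F₀ (F.F₀ X)
  ; F₁ = λ f → G.F₁ (F.F₁ f)
  ; identity = IsEquivalence.trans E.equiv (G.F-resp-≈ F.identity) G.identity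
  ; homomorphism = IsEquivalence.trans E.equiv (G.F-resp-≈ F.homomorphism) G.homomorphism
  ; F-resp-≈ = λ p → G.F-resp-≈ (F.F-resp-≈ p) }
  where
    module F = Functor F
    module G = Functor G
    module E = Category E

record NaturalIsomorphism {o ℓ e o′ ℓ′ e′} {C : Category o ℓ e} {D : Category o′ ℓ′ e′}
       (F G : Functor C D) : Set (o ⊔ ℓ ⊔ e ⊔ o′ ⊔ ℓ′ ⊔ e′) where
  private
    module C = Category C
    module D = Category D
    module F = Functor F
    module G = Functor G
  field
    η       : ∀ X → D.Hom (F.F₀ X) (G.F₀ X)
    η⁻¹     : ∀ X → D.Hom (G.F₀ X) (F.F₀ X)
    commute : ∀ {X Y} (f : C.Hom X Y) → η Y D.∘ F.F₁ f D.≈ G.F₁ f D.∘ η X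
    isoˡ    : ∀ X → η⁻¹ X D.∘ η X D.≈ D.id
    isoʳ    : ∀ X → η X D.∘ η⁻¹ X D.≈ D.id

record Equivalence {o ℓ e o′ ℓ′ e′} (C : Category o ℓ e) (D : Category o′ ℓ′ e′)
       : Set (o ⊔ ℓ ⊔ e ⊔ o′ ⊔ ℓ′ ⊔ e′) where
  field
    F    : Functor C D
    G    : Functor D C
    unit : NaturalIsomorphism (G ∘F F) idF
    counit : NaturalIsomorphism (F ∘F G) idF

module AsmDefs (T : TCA) where
  open TCA T

  record Assembly : Set₁ where
    field
      Carrier : Set
      type    : Ty
      _⊩_     : 𝒜 type → Carrier → Set
      total   : ∀ x → ∃ λ a → a ⊩ x
  open Assembly

  Tracked : (X Y : Assembly) → (Carrier X → Carrier Y) → Set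
  Tracked X Y f = ∃ λ (e : 𝒜 (type X ⇒ type Y)) →
                  ∀ (a : 𝒜 (type X)) (x : Carrier X) → _⊩_ X a x → _⊩_ Y (e · a) (f x)

  record AsmHom (X Y : Assembly) : Set where
    constructor asmHom
    field
      fun     : Carrier X → Carrier Y
      tracked : Tracked X Y fun
  open AsmHom

  _≈A_ : ∀ {X Y} → AsmHom X Y → AsmHom X Y → Set
  f ≈A g = ∀ x → fun f x ≡ fun g x

  idA : ∀ {X} → AsmHom X X
  idA {X} = asmHom (λ x → x) (i , λ a x r → substR (i-eq a) r)
    where
      substR : ∀ {a b : 𝒜 (type X)} {x} → a ≡ b → _⊩_ X b x → _⊩_ X a x
      substR refl r = r

  _∘A_ : ∀ {X Y Z} → AsmHom Y Z → AsmHom X Y → AsmHom X Z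
  _∘A_ {X} {Y} {Z} (asmHom g (eg , rg)) (asmHom f (ef , rf)) =
    asmHom (λ x → g (f x))
      (comp eg ef , λ a x r → tr (comp-eq eg ef a) (rg (ef · a) (f x) (rf a x r)))
    where
      tr : ∀ {b c : 𝒜 (type Z)} {z} → b ≡ c → _⊩_ Z c z → _⊩_ Z b z
      tr refl r = r

Asm : TCA → Category (lsuc lzero) lzero lzero
Asm T = record
  { Obj = Assembly
  ; Hom = AsmHom
  ; _≈_ = _≈A_
  ; id = idA
  ; _∘_ = _∘A_
  ; equiv = record { refl = λ _ → refl ; sym = λ p x → sym (p x)
                   ; trans = λ p q x → trans (p x) (q x) }
  ; ∘-resp-≈ = λ {_} {_} {_} {f} {h} {g} {i} p q x →
                 trans (cong (AsmHom.fun f) (q x)) (p (AsmHom.fun i x))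
  ; identityˡ = λ _ → refl
  ; identityʳ = λ _ → refl
  ; assoc = λ _ → refl }
  where open AsmDefs T

module Submission where

open import Defs
open import Data.Unit using (tt)
open import Data.Maybe using (nothing; just)
open import Data.Product using (Σ; ∃; _,_; proj₁; proj₂)
open import Relation.Binary.PropositionalEquality using (_≡_; refl; sym; subst)

-- Assemblies over 𝒜 include into assemblies over 𝒜¹ unchanged. Conversely, the
-- unit type is replaced by an arbitrary type of 𝒜 all of whose elements realize
-- everything, which loses nothing since the only realizer in 𝒜¹₁ is *. A map
-- out of an assembly over 1 is tracked by an element e of the target type, and
-- the constant function k e tracks it after lowering.

module AugmentationEquivalence (T : TCA) where
  open TCA T
  open Augmentation T
  open AsmDefs T
  module ¹ = AsmDefs (Aug T)
  open Assembly
  open ¹.Assembly renaming (Carrier to Carrier¹; type to type¹; _⊩_ to _⊩¹_; total to total¹)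

  lower : Ty¹ → Ty
  lower nothing  = ty₀
  lower (just A) = A

  raise : ∀ t → 𝒜 (lower t) → 𝒜¹ t
  raise nothing  _ = tt
  raise (just A) a = a

  lower-app : ∀ s t (e : 𝒜¹ (s ⇒¹ t)) →
              Σ (𝒜 (lower s ⇒ lower t)) λ e′ →
                ∀ a → raise t (e′ · a) ≡ app¹ {s} {t} e (raise s a)
  lower-app nothing  nothing  e = inhab _ , λ _ → refl
  lower-app nothing  (just B) e = k · e , k-eq e
  lower-app (just A) nothing  e = inhab _ , λ _ → refl
  lower-app (just A) (just B) e = e , λ _ → refl

  raise-representable : ∀ t →
    Σ (𝒜¹ (just (lower t) ⇒¹ t)) λ e → ∀ a → app¹ {just (lower t)} {t} e a ≡ raise t a
  raise-representable nothing  = tt , λ _ → refl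
  raise-representable (just A) = i , i-eq

  raise-section : ∀ t →
    Σ (𝒜¹ (t ⇒¹ just (lower t))) λ e → ∀ a → raise t (app¹ {t} {just (lower t)} e a) ≡ a
  raise-section nothing  = inhab ty₀ , λ _ → refl
  raise-section (just A) = i , i-eq

  ⊩¹-resp : ∀ Y {b c : 𝒜¹ (type¹ Y)} {y} → b ≡ c → _⊩¹_ Y c y → _⊩¹_ Y b y
  ⊩¹-resp Y b≡c = subst (λ b → _⊩¹_ Y b _) (sym b≡c)

  lower-total : ∀ t {C : Set} (_⊩′_ : 𝒜¹ t → C → Set) →
                (∀ y → ∃ λ b → b ⊩′ y) → ∀ y → ∃ λ a → raise t a ⊩′ y
  lower-total nothing  _⊩′_ total′ y = inhab ty₀ , proj₂ (total′ y)
  lower-total (just A) _⊩′_ total′   = total′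

  include : Assembly → ¹.Assembly
  include X = record { Carrier = Carrier X ; type = just (type X) ; _⊩_ = _⊩_ X ; total = total X }

  lowerAsm : ¹.Assembly → Assembly
  lowerAsm Y = record
    { Carrier = Carrier¹ Y
    ; type    = lower (type¹ Y)
    ; _⊩_     = λ a y → _⊩¹_ Y (raise (type¹ Y) a) y
    ; total   = lower-total (type¹ Y) (_⊩¹_ Y) (total¹ Y) }

  includeHom : ∀ {X Y} → AsmHom X Y → ¹.AsmHom (include X) (include Y)
  includeHom (asmHom f tracks) = ¹.asmHom f tracks

  lowerHom : ∀ {X Y} → ¹.AsmHom X Y → AsmHom (lowerAsm X) (lowerAsm Y)
  lowerHom {X} {Y} (¹.asmHom f (e , tracks)) =
    asmHom f (e′ , λ a x r → ⊩¹-resp Y (simulates a) (tracks _ x r))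
    where
      e′        = proj₁ (lower-app (type¹ X) (type¹ Y) e)
      simulates = proj₂ (lower-app (type¹ X) (type¹ Y) e)

  fromLowered : ∀ Y → ¹.AsmHom (include (lowerAsm Y)) Y
  fromLowered Y = ¹.asmHom (λ y → y) (e , λ a y r → ⊩¹-resp Y (app≡raise a) r)
    where
      e         = proj₁ (raise-representable (type¹ Y))
      app≡raise = proj₂ (raise-representable (type¹ Y))

  toLowered : ∀ Y → ¹.AsmHom Y (include (lowerAsm Y))
  toLowered Y = ¹.asmHom (λ y → y) (e , λ a y r → ⊩¹-resp Y (raise∘app≡id a) r)
    where
      e            = proj₁ (raise-section (type¹ Y))
      raise∘app≡id = proj₂ (raise-section (type¹ Y))

  inclusion : Functor (Asm T) (Asm (Aug T))
  inclusion = record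
    { F₀ = include ; F₁ = includeHom
    ; identity = λ _ → refl ; homomorphism = λ _ → refl ; F-resp-≈ = λ p → p }

  lowering : Functor (Asm (Aug T)) (Asm T)
  lowering = record
    { F₀ = lowerAsm ; F₁ = lowerHom
    ; identity = λ _ → refl ; homomorphism = λ _ → refl ; F-resp-≈ = λ p → p }

  equivalence : Equivalence (Asm T) (Asm (Aug T))
  equivalence = record
    { F = inclusion
    ; G = lowering
    -- lowerAsm (include X) is X on the nose, so the unit is the identity.
    ; unit = record
        { η = λ _ → idA ; η⁻¹ = λ _ → idA
        ; commute = λ _ _ → refl ; isoˡ = λ _ _ → refl ; isoʳ = λ _ _ → refl }
    ; counit = record
        { η = fromLowered ; η⁻¹ = toLowered
        ; commute = λ _ _ → refl ; isoˡ = λ _ _ → refl ; isoʳ = λ _ _ → refl } }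

mainTheorem1 : (𝒜 : TCA) → Equivalence (Asm 𝒜) (Asm (Aug 𝒜))
mainTheorem1 = AugmentationEquivalence.equivalence
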